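{- Let $n=2^s$, $q=2^r$ ($s,r$ positive integers), $N=|SL(n,q)|$, and let $\{C_i\}_{i=0}^N$ be the weight distribution of the binary code $C=C(SL(n,q))$. Then $C_i=C_{N-i}$ for all $0\le i\le N$.
   Context: $Tr$ is the matrix trace; fix an ordering $g_1,\dots,g_N$ of $SL(n,q)$, let $v=(Tr(g_1),\dots,Tr(g_N))\in\mathbb{F}_q^N$ and $C(SL(n,q))=\{u\in\mathbb{F}_2^N:u\cdot v=0\}$ (dot product in $\mathbb{F}_q$); $C_i$ is the number of codewords of Hamming weight $i$. -}

module Defs where

open import Level using (Level; _⊔_) renaming (suc to lsuc)
open import Data.Nat using (ℕ; zero; suc; _≡ᵇ_)
open import Data.Bool using (Bool; true; false; _∧_; if_then_else_)
open import Data.Fin using (Fin; zero; suc; punchIn)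
open import Data.List using (List; []; _∷_; map; concatMap; filter; length; allFin)
open import Data.Product using (Σ; ∃; _,_)
open import Relation.Nullary using (¬_; does)
open import Relation.Binary using (Decidable)
open import Relation.Binary.PropositionalEquality using (_≡_)
open import Algebra.Bundles using (CommutativeRing)

record FiniteField (c ℓ : Level) : Set (lsuc (c ⊔ ℓ)) where
  field
    commRing  : CommutativeRing c ℓ
  open CommutativeRing commRing public
  field
    1≉0       : ¬ (1# ≈ 0#)
    inverse   : ∀ x → ¬ (x ≈ 0#) → ∃ λ y → (x * y) ≈ 1#
    _≟_       : Decidable _≈_
    size      : ℕ
    enum      : Fin size → Carrier
    enum-surj : ∀ x → ∃ λ i → enum i ≈ x
    enum-inj  : ∀ i j → enum i ≈ enum j → i ≡ j

module FieldDefs {c ℓ : Level} (F : FiniteField c ℓ) where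
  open FiniteField F using (Carrier; _≈_; 0#; 1#; _+_; _*_; _-_; _≟_; size; enum)

  Matrix : ℕ → Set c
  Matrix n = Fin n → Fin n → Carrier

  Σ[_] : (n : ℕ) → (Fin n → Carrier) → Carrier
  Σ[ zero ] f = 0#
  Σ[ suc n ] f = f zero + Σ[ n ] (λ i → f (suc i))

  trace : ∀ {n} → Matrix n → Carrier
  trace {n} M = Σ[ n ] (λ i → M i i)

  det : ∀ n → Matrix n → Carrier
  det zero M = 1#
  det (suc n) M = go (suc n) (λ j → M zero j) (λ j → det n (minor j))
    where
      minor : Fin (suc n) → Matrix n
      minor j i k = M (suc i) (punchIn j k)
      -- alternating sum  Σ_j (-1)^j a_j d_j
      go : ∀ m → (Fin m → Carrier) → (Fin m → Carrier) → Carrier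
      go zero a d = 0#
      go (suc m) a d = (a zero * d zero) - go m (λ j → a (suc j)) (λ j → d (suc j))

  elements : List Carrier
  elements = map enum (allFin size)

  allFuns : ∀ {a} {A : Set a} (k : ℕ) → List A → List (Fin k → A)
  allFuns zero xs = (λ ()) ∷ []
  allFuns (suc k) xs =
    concatMap (λ x → map (λ f → λ { zero → x ; (suc i) → f i }) (allFuns k xs)) xs

  allMatrices : ∀ n → List (Matrix n)
  allMatrices n = allFuns n (allFuns n elements)

  -- a fixed ordering g_1, …, g_N of SL(n,F)
  SL : ∀ n → List (Matrix n)
  SL n = filter (λ M → det n M ≟ 1#) (allMatrices n)

  traceVector : ∀ n → List Carrier
  traceVector n = map trace (SL n)

  allWords : ℕ → List (List Bool)
  allWords zero = [] ∷ []
  allWords (suc N) = concatMap (λ b → map (b ∷_) (allWords N)) (true ∷ false ∷ [])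

  weight : List Bool → ℕ
  weight [] = 0
  weight (true ∷ u) = suc (weight u)
  weight (false ∷ u) = weight u

  -- u · v computed in F, with 0,1 ∈ F₂ embedded in F
  dot : List Bool → List Carrier → Carrier
  dot (b ∷ u) (x ∷ v) = (if b then x else 0#) + dot u v
  dot _ _ = 0#

  N : ℕ → ℕ
  N n = length (SL n)

  isCodeword : ∀ n → List Bool → Bool
  isCodeword n u = does (dot u (traceVector n) ≟ 0#)

  weightDist : ∀ n → ℕ → ℕ
  weightDist n i =
    length (filter (λ u → isCodeword n u ∧ (weight u ≡ᵇ i) Data.Bool.≟ true) (allWords (N n)))

{-# OPTIONS --safe #-}
module Submission where

-- Complementing every letter is a bijection of binary words of length N sending weight w to
-- N ∸ w, and dot ū v + dot u v = Σ v, so C_i = C_{N−i} as soon as the traces of SL(n, q) sum to 0.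
-- Expand det along the first row and fix the lower rows and the entry x = M₁₁. The number of ways
-- to complete the first row to determinant 1 counts the solutions of an affine equation in n − 1
-- unknowns; it is 0 or a power of q, hence 0 in F_q (where q · 1 = 0) when n ≥ 3. For n = 2 it is
-- 1 or 0 according as M₂₁ ≠ 0, independently of x, and the free entry M₂₂ contributes a factor q.

open import Defs
open import Level using (Level)
open import Algebra.Bundles using (CommutativeRing)
open import Data.Bool using (Bool; true; false; not; if_then_else_; _∧_)
import Data.Bool as Bool
open import Data.Fin using (Fin; zero; suc; punchIn)
open import Data.Fin.Properties using (punchInᵢ≢i)
open import Data.List using (List; []; _∷_; _++_; map; concatMap; filter; length; tabulate; allFin)
open import Data.List.Properties using (length-map; length-tabulate; length-++; filter-++; ++-identityʳ)
open import Data.Nat as ℕ using (ℕ; zero; suc; _^_; _≤_; _∸_; z≤n; s≤s)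
import Data.Nat.Properties as ℕₚ
open import Data.Product using (_,_)
open import Data.Vec.Functional as Vec using (Vector; head; tail)
open import Function using (_∘_; _$_; id; _⇔_; mk⇔; Equivalence)
import Function.Properties.Equivalence as ⇔
open import Relation.Binary.PropositionalEquality as ≡ using (_≡_; _≢_; _≗_; cong; cong₂)
open import Relation.Nullary using (¬_; Dec; yes; no; does; ¬?)
open import Relation.Nullary.Decidable using (dec-true; dec-false)

does-cong : ∀ {p q} {P : Set p} {Q : Set q} (P? : Dec P) (Q? : Dec Q) → P ⇔ Q → does P? ≡ does Q?
does-cong (yes p) Q? P⇔Q = ≡.sym (dec-true Q? (Equivalence.to P⇔Q p))
does-cong (no ¬p) Q? P⇔Q = ≡.sym (dec-false Q? (¬p ∘ Equivalence.from P⇔Q))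

m∸n≡o⇔n≡m∸o : ∀ {m n o} → n ≤ m → o ≤ m → (m ∸ n ≡ o) ⇔ (n ≡ m ∸ o)
m∸n≡o⇔n≡m∸o {m} {n} {o} n≤m o≤m = mk⇔
  (λ m∸n≡o → ≡.trans (≡.sym (ℕₚ.m∸[m∸n]≡n n≤m)) (cong (m ∸_) m∸n≡o))
  (λ n≡m∸o → ≡.trans (cong (m ∸_) n≡m∸o) (ℕₚ.m∸[m∸n]≡n o≤m))

module Sums {c ℓ} (R : CommutativeRing c ℓ) where
  open CommutativeRing R hiding (zero)
  open import Algebra.Properties.CommutativeSemigroup +-commutativeSemigroup using (interchange)
  open import Algebra.Properties.CommutativeMonoid.Sum +-commutativeMonoid using (sum-remove; sum-cong-≋; sum-replicate-zero)
  open import Algebra.Properties.CommutativeMonoid.Sum +-commutativeMonoid public using (sum)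
  open import Algebra.Definitions.RawMonoid +-rawMonoid using (_×_)
  open import Relation.Binary.Reasoning.Setoid setoid

  ∑ : ∀ {a} {A : Set a} → List A → (A → Carrier) → Carrier
  ∑ []       f = 0#
  ∑ (x ∷ xs) f = f x + ∑ xs f

  𝟙 : ∀ {p} {P : Set p} → Dec P → Carrier
  𝟙 P? = if does P? then 1# else 0#

  𝟙-yes : ∀ {p} {P : Set p} (P? : Dec P) → P → 𝟙 P? ≈ 1#
  𝟙-yes P? p = reflexive (cong (λ b → if b then 1# else 0#) (dec-true P? p))

  𝟙-no : ∀ {p} {P : Set p} (P? : Dec P) → ¬ P → 𝟙 P? ≈ 0#
  𝟙-no P? ¬p = reflexive (cong (λ b → if b then 1# else 0#) (dec-false P? ¬p))

  𝟙-cong : ∀ {p q} {P : Set p} {Q : Set q} (P? : Dec P) (Q? : Dec Q) → P ⇔ Q → 𝟙 P? ≈ 𝟙 Q?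
  𝟙-cong P? Q? P⇔Q = reflexive (cong (λ b → if b then 1# else 0#) (does-cong P? Q? P⇔Q))

  module _ {a} {A : Set a} where

    ∑-cong : ∀ (xs : List A) {f g : A → Carrier} → (∀ x → f x ≈ g x) → ∑ xs f ≈ ∑ xs g
    ∑-cong []       f≈g = refl
    ∑-cong (x ∷ xs) f≈g = +-cong (f≈g x) (∑-cong xs f≈g)

    ∑-++ : ∀ (xs ys : List A) f → ∑ (xs ++ ys) f ≈ ∑ xs f + ∑ ys f
    ∑-++ []       ys f = sym (+-identityˡ _)
    ∑-++ (x ∷ xs) ys f = trans (+-congˡ (∑-++ xs ys f)) (sym (+-assoc _ _ _))

    ∑-+ : ∀ (xs : List A) f g → ∑ xs (λ x → f x + g x) ≈ ∑ xs f + ∑ xs g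
    ∑-+ []       f g = sym (+-identityˡ 0#)
    ∑-+ (x ∷ xs) f g = trans (+-congˡ (∑-+ xs f g)) (interchange _ _ _ _)

    ∑-*ˡ : ∀ (xs : List A) k f → ∑ xs (λ x → k * f x) ≈ k * ∑ xs f
    ∑-*ˡ []       k f = sym (zeroʳ k)
    ∑-*ˡ (x ∷ xs) k f = trans (+-congˡ (∑-*ˡ xs k f)) (sym (distribˡ k _ _))

    ∑-*ʳ : ∀ (xs : List A) k f → ∑ xs (λ x → f x * k) ≈ ∑ xs f * k
    ∑-*ʳ []       k f = sym (zeroˡ k)
    ∑-*ʳ (x ∷ xs) k f = trans (+-congˡ (∑-*ʳ xs k f)) (sym (distribʳ k _ _))

    ∑-0 : ∀ (xs : List A) → ∑ xs (λ _ → 0#) ≈ 0#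
    ∑-0 []       = refl
    ∑-0 (x ∷ xs) = trans (+-identityˡ _) (∑-0 xs)

    ∑-const : ∀ (xs : List A) v → ∑ xs (λ _ → v) ≡ length xs × v
    ∑-const []       v = ≡.refl
    ∑-const (x ∷ xs) v = cong (v +_) (∑-const xs v)

    ∑-filter : ∀ {p} {P : A → Set p} (P? : ∀ x → Dec (P x)) xs f →
      ∑ (filter P? xs) f ≈ ∑ xs (λ x → 𝟙 (P? x) * f x)
    ∑-filter P? []       f = refl
    ∑-filter P? (x ∷ xs) f with does (P? x)
    ... | true  = +-cong (sym (*-identityˡ _)) (∑-filter P? xs f)
    ... | false = trans (∑-filter P? xs f) (sym (trans (+-congʳ (zeroˡ _)) (+-identityˡ _)))

    ∑-tabulate : ∀ {n} (g : Fin n → A) f → ∑ (tabulate g) f ≡ sum (f ∘ g)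
    ∑-tabulate {zero}  g f = ≡.refl
    ∑-tabulate {suc n} g f = cong (f (g zero) +_) (∑-tabulate (g ∘ suc) f)

  module _ {a b} {A : Set a} {B : Set b} where

    ∑-map : ∀ (h : A → B) xs f → ∑ (map h xs) f ≡ ∑ xs (f ∘ h)
    ∑-map h []       f = ≡.refl
    ∑-map h (x ∷ xs) f = cong (f (h x) +_) (∑-map h xs f)

    ∑-concatMap : ∀ (h : A → List B) xs f → ∑ (concatMap h xs) f ≈ ∑ xs (λ x → ∑ (h x) f)
    ∑-concatMap h []       f = refl
    ∑-concatMap h (x ∷ xs) f = trans (∑-++ (h x) (concatMap h xs) f) (+-congˡ (∑-concatMap h xs f))

    ∑-swap : ∀ xs ys (f : A → B → Carrier) → ∑ xs (λ x → ∑ ys (f x)) ≈ ∑ ys (λ y → ∑ xs (λ x → f x y))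
    ∑-swap []       ys f = sym (∑-0 ys)
    ∑-swap (x ∷ xs) ys f = trans (+-congˡ (∑-swap xs ys f)) (sym (∑-+ ys (f x) (λ y → ∑ xs (λ x → f x y))))

  sum-delta : ∀ {n} (t : Vector Carrier n) i → (∀ j → j ≢ i → t j ≈ 0#) → sum t ≈ t i
  sum-delta {suc n} t i off = begin
    sum t                          ≈⟨ sum-remove t ⟩
    t i + sum (t ∘ punchIn i)      ≈⟨ +-congˡ (sum-cong-≋ (λ j → off (punchIn i j) (punchInᵢ≢i i j))) ⟩
    t i + sum (Vec.replicate n 0#) ≈⟨ +-congˡ (sum-replicate-zero n) ⟩
    t i + 0#                       ≈⟨ +-identityʳ _ ⟩
    t i                            ∎

module Words {c ℓ : Level} (F : FiniteField c ℓ) where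
  open FieldDefs F using (weight; allWords)
  open ≡.≡-Reasoning

  weight≤length : ∀ u → weight u ≤ length u
  weight≤length []          = z≤n
  weight≤length (true ∷ u)  = s≤s (weight≤length u)
  weight≤length (false ∷ u) = ℕₚ.m≤n⇒m≤1+n (weight≤length u)

  weight-complement : ∀ u → weight (map not u) ≡ length u ∸ weight u
  weight-complement []          = ≡.refl
  weight-complement (true ∷ u)  = weight-complement u
  weight-complement (false ∷ u) =
    ≡.trans (cong suc (weight-complement u)) (≡.sym (ℕₚ.+-∸-assoc 1 (weight≤length u)))

  count : (List Bool → Bool) → List (List Bool) → ℕ
  count P us = length (filter (λ u → P u Bool.≟ true) us)

  count-singleton : ∀ P u → count P (u ∷ []) ≡ (if P u then 1 else 0)
  count-singleton P u with P u
  ... | true  = ≡.refl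
  ... | false = ≡.refl

  count-++ : ∀ P us vs → count P (us ++ vs) ≡ count P us ℕ.+ count P vs
  count-++ P us vs = ≡.trans (cong length (filter-++ (λ u → P u Bool.≟ true) us vs)) (length-++ (filter _ us))

  count-map : ∀ P (f : List Bool → List Bool) us → count P (map f us) ≡ count (P ∘ f) us
  count-map P f []       = ≡.refl
  count-map P f (u ∷ us) with P (f u)
  ... | true  = cong suc (count-map P f us)
  ... | false = count-map P f us

  count-allWords-suc : ∀ P N →
    count P (allWords (suc N)) ≡ count (P ∘ (true ∷_)) (allWords N) ℕ.+ count (P ∘ (false ∷_)) (allWords N)
  count-allWords-suc P N = begin
    count P (map (true ∷_) W ++ (map (false ∷_) W ++ []))
      ≡⟨ count-++ P (map (true ∷_) W) _ ⟩
    count P (map (true ∷_) W) ℕ.+ count P (map (false ∷_) W ++ [])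
      ≡⟨ cong₂ ℕ._+_ (count-map P (true ∷_) W) (≡.trans (cong (count P) (++-identityʳ (map (false ∷_) W))) (count-map P (false ∷_) W)) ⟩
    count (P ∘ (true ∷_)) W ℕ.+ count (P ∘ (false ∷_)) W
      ∎
    where W = allWords N

  count-allWords-complement : ∀ N P → count P (allWords N) ≡ count (P ∘ map not) (allWords N)
  count-allWords-complement zero    P = ≡.trans (count-singleton P []) (≡.sym (count-singleton (P ∘ map not) []))
  count-allWords-complement (suc N) P = begin
    count P (allWords (suc N))
      ≡⟨ count-allWords-suc P N ⟩
    count (P ∘ (true ∷_)) W ℕ.+ count (P ∘ (false ∷_)) W
      ≡⟨ cong₂ ℕ._+_ (count-allWords-complement N (P ∘ (true ∷_))) (count-allWords-complement N (P ∘ (false ∷_))) ⟩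
    count (λ u → P (true ∷ map not u)) W ℕ.+ count (λ u → P (false ∷ map not u)) W
      ≡⟨ ℕₚ.+-comm (count (λ u → P (true ∷ map not u)) W) _ ⟩
    count (λ u → P (false ∷ map not u)) W ℕ.+ count (λ u → P (true ∷ map not u)) W
      ≡⟨ count-allWords-suc (P ∘ map not) N ⟨
    count (P ∘ map not) (allWords (suc N))
      ∎
    where W = allWords N

  count-allWords-cong : ∀ N {P Q} → (∀ u → length u ≡ N → P u ≡ Q u) → count P (allWords N) ≡ count Q (allWords N)
  count-allWords-cong zero {P} {Q} P≗Q = begin
    count P ([] ∷ [])           ≡⟨ count-singleton P [] ⟩
    (if P [] then 1 else 0)     ≡⟨ cong (if_then 1 else 0) (P≗Q [] ≡.refl) ⟩
    (if Q [] then 1 else 0)     ≡⟨ count-singleton Q [] ⟨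
    count Q ([] ∷ [])           ∎
  count-allWords-cong (suc N) {P} {Q} P≗Q = begin
    count P (allWords (suc N))
      ≡⟨ count-allWords-suc P N ⟩
    count (P ∘ (true ∷_)) W ℕ.+ count (P ∘ (false ∷_)) W
      ≡⟨ cong₂ ℕ._+_ (count-allWords-cong N (λ u |u|≡N → P≗Q (true ∷ u) (cong suc |u|≡N)))
                     (count-allWords-cong N (λ u |u|≡N → P≗Q (false ∷ u) (cong suc |u|≡N))) ⟩
    count (Q ∘ (true ∷_)) W ℕ.+ count (Q ∘ (false ∷_)) W
      ≡⟨ count-allWords-suc Q N ⟨
    count Q (allWords (suc N))
      ∎
    where W = allWords N

module _ {c ℓ : Level} (F : FiniteField c ℓ) where
  open FiniteField F hiding (zero)
  open FieldDefs F
  open Sums commRing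
  open Words F
  open import Algebra.Properties.Ring ring
    using (//-rightDividesˡ; //-rightDividesʳ; ⁻¹-anti-homo‿-; xyx⁻¹≈y; -0#≈0#; +-identityʳ-unique; +-inverseʳ-unique)
  open import Algebra.Properties.CommutativeSemigroup +-commutativeSemigroup using (interchange)
  open import Algebra.Properties.Semiring.Mult semiring using (_×_; ×-congʳ; ×-assoc-*)
  open import Relation.Binary.Reasoning.Setoid setoid

  x-[x-y]≈y : ∀ x y → x - (x - y) ≈ y
  x-[x-y]≈y x y = begin
    x - (x - y)  ≈⟨ +-congˡ (⁻¹-anti-homo‿- x y) ⟩
    x + (y - x)  ≈⟨ +-assoc x y (- x) ⟨
    x + y - x    ≈⟨ xyx⁻¹≈y x y ⟩
    y            ∎

  x-y≈z⇔y≈x-z : ∀ {x y z} → (x - y ≈ z) ⇔ (y ≈ x - z)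
  x-y≈z⇔y≈x-z {x} {y} {z} = mk⇔
    (λ x-y≈z → sym (trans (+-congˡ (-‿cong (sym x-y≈z))) (x-[x-y]≈y x y)))
    (λ y≈x-z → trans (+-congˡ (-‿cong y≈x-z)) (x-[x-y]≈y x z))

  x≈y+z⇔y≈x-z : ∀ {x y z} → (x ≈ y + z) ⇔ (y ≈ x - z)
  x≈y+z⇔y≈x-z {x} {y} {z} = mk⇔
    (λ x≈y+z → sym (trans (+-congʳ x≈y+z) (//-rightDividesʳ z y)))
    (λ y≈x-z → sym (trans (+-congʳ y≈x-z) (//-rightDividesˡ z x)))

  0≈x-y⇔x≈y : ∀ {x y} → (0# ≈ x - y) ⇔ (x ≈ y)
  0≈x-y⇔x≈y {x} {y} = ⇔.trans (⇔.sym x≈y+z⇔y≈x-z) (mk⇔ (λ e → trans e (+-identityˡ y)) (λ e → trans e (sym (+-identityˡ y))))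

  x*d≈b⇔x≈b*w : ∀ {x d b w} → d * w ≈ 1# → (x * d ≈ b) ⇔ (x ≈ b * w)
  x*d≈b⇔x≈b*w {x} {d} {b} {w} d*w≈1 = mk⇔
    (λ x*d≈b → begin
      x            ≈⟨ *-identityʳ x ⟨
      x * 1#       ≈⟨ *-congˡ d*w≈1 ⟨
      x * (d * w)  ≈⟨ *-assoc x d w ⟨
      x * d * w    ≈⟨ *-congʳ x*d≈b ⟩
      b * w        ∎)
    (λ x≈b*w → begin
      x * d        ≈⟨ *-congʳ x≈b*w ⟩
      b * w * d    ≈⟨ *-assoc b w d ⟩
      b * (w * d)  ≈⟨ *-congˡ (trans (*-comm w d) d*w≈1) ⟩
      b * 1#       ≈⟨ *-identityʳ b ⟩
      b            ∎)

  ∑-elements : ∀ f → ∑ elements f ≡ sum (f ∘ enum)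
  ∑-elements f = ≡.trans (∑-map enum (allFin size) f) (∑-tabulate id (f ∘ enum))

  ∑-elements-delta : ∀ k (h : Carrier → Carrier) → (∀ {x y} → x ≈ y → h x ≈ h y) →
    ∑ elements (λ z → 𝟙 (z ≟ k) * h z) ≈ h k
  ∑-elements-delta k h h-cong with enum-surj k
  ... | i₀ , enum-i₀≈k = begin
    ∑ elements (λ z → 𝟙 (z ≟ k) * h z)          ≡⟨ ∑-elements _ ⟩
    sum (λ i → 𝟙 (enum i ≟ k) * h (enum i))     ≈⟨ sum-delta _ i₀ off ⟩
    𝟙 (enum i₀ ≟ k) * h (enum i₀)               ≈⟨ *-cong (𝟙-yes (enum i₀ ≟ k) enum-i₀≈k) (h-cong enum-i₀≈k) ⟩
    1# * h k                                    ≈⟨ *-identityˡ _ ⟩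
    h k                                         ∎
    where
    off : ∀ j → j ≢ i₀ → 𝟙 (enum j ≟ k) * h (enum j) ≈ 0#
    off j j≢i₀ = trans (*-congʳ (𝟙-no (enum j ≟ k) (j≢i₀ ∘ enum-inj j i₀ ∘ λ e → trans e (sym enum-i₀≈k)))) (zeroˡ _)

  -- Instead of building the permutation y ↦ y + t, write y + t as a delta sum and swap the summations.
  ∑-elements-translate : ∀ t → ∑ elements (λ y → y + t) ≈ ∑ elements id
  ∑-elements-translate t = begin
    ∑ elements (λ y → y + t)
      ≈⟨ ∑-cong elements (λ y → sym (∑-elements-delta (y + t) id id)) ⟩
    ∑ elements (λ y → ∑ elements (λ z → 𝟙 (z ≟ (y + t)) * z))
      ≈⟨ ∑-swap elements elements _ ⟩
    ∑ elements (λ z → ∑ elements (λ y → 𝟙 (z ≟ (y + t)) * z))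
      ≈⟨ ∑-cong elements (λ z → ∑-cong elements (λ y →
           *-congʳ (𝟙-cong (z ≟ (y + t)) (y ≟ (z - t)) x≈y+z⇔y≈x-z))) ⟩
    ∑ elements (λ z → ∑ elements (λ y → 𝟙 (y ≟ (z - t)) * z))
      ≈⟨ ∑-cong elements (λ z → ∑-elements-delta (z - t) (λ _ → z) (λ _ → refl)) ⟩
    ∑ elements id
      ∎

  length-elements : length elements ≡ size
  length-elements = ≡.trans (length-map enum (allFin size)) (length-tabulate id)

  size×1≈0 : size × 1# ≈ 0#
  size×1≈0 = +-identityʳ-unique (∑ elements id) (size × 1#) (begin
    ∑ elements id + size × 1#                  ≡⟨ cong (λ n → ∑ elements id + n × 1#) length-elements ⟨
    ∑ elements id + length elements × 1#       ≡⟨ cong (∑ elements id +_) (∑-const elements 1#) ⟨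
    ∑ elements id + ∑ elements (λ _ → 1#)      ≈⟨ ∑-+ elements id (λ _ → 1#) ⟨
    ∑ elements (λ y → y + 1#)                  ≈⟨ ∑-elements-translate 1# ⟩
    ∑ elements id                              ∎)

  ∑-elements-const : ∀ v → ∑ elements (λ _ → v) ≈ 0#
  ∑-elements-const v = begin
    ∑ elements (λ _ → v)   ≡⟨ ∑-const elements v ⟩
    length elements × v    ≡⟨ cong (_× v) length-elements ⟩
    size × v               ≈⟨ ×-congʳ size (*-identityˡ v) ⟨
    size × (1# * v)        ≈⟨ ×-assoc-* size 1# v ⟨
    (size × 1#) * v        ≈⟨ *-congʳ size×1≈0 ⟩
    0# * v                 ≈⟨ zeroˡ v ⟩
    0#                     ∎

  ∑-allFuns-suc : ∀ {a} {A : Set a} k (xs : List A) (f : Vector A (suc k) → Carrier) →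
    (∀ {u v} → u ≗ v → f u ≈ f v) →
    ∑ (allFuns (suc k) xs) f ≈ ∑ xs (λ x → ∑ (allFuns k xs) (λ g → f (x Vec.∷ g)))
  ∑-allFuns-suc k xs f f-cong = trans (∑-concatMap _ xs f) (∑-cong xs (λ x →
    trans (reflexive (∑-map _ (allFuns k xs) f))
          (∑-cong (allFuns k xs) (λ g → f-cong λ { zero → ≡.refl ; (suc i) → ≡.refl }))))

  vectors : ∀ m → List (Vector Carrier m)
  vectors m = allFuns m elements

  ∑-vectors-head : ∀ l (f : Carrier → Carrier) → ∑ (vectors (suc (suc l))) (f ∘ head) ≈ 0#
  ∑-vectors-head l f = begin
    ∑ (vectors (suc (suc l))) (f ∘ head)
      ≈⟨ ∑-allFuns-suc (suc l) elements (f ∘ head) (λ u≗v → reflexive (cong f (u≗v zero))) ⟩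
    ∑ elements (λ x → ∑ (vectors (suc l)) (λ _ → f x))
      ≈⟨ ∑-cong elements (λ x → ∑-allFuns-suc l elements _ (λ _ → refl)) ⟩
    ∑ elements (λ x → ∑ elements (λ _ → ∑ (vectors l) (λ _ → f x)))
      ≈⟨ ∑-cong elements (λ x → ∑-elements-const _) ⟩
    ∑ elements (λ _ → 0#)
      ≈⟨ ∑-0 elements ⟩
    0#
      ∎

  alternatingSum : ∀ m → Vector Carrier m → Vector Carrier m → Carrier
  alternatingSum zero    a d = 0#
  alternatingSum (suc m) a d = head a * head d - alternatingSum m (tail a) (tail d)

  alternatingSum-unique : (g : ∀ m → Vector Carrier m → Vector Carrier m → Carrier) →
    (∀ a d → g zero a d ≡ 0#) →
    (∀ m a d → g (suc m) a d ≡ head a * head d - g m (tail a) (tail d)) →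
    ∀ m a d → g m a d ≡ alternatingSum m a d
  alternatingSum-unique g g-zero g-suc zero    a d = g-zero a d
  alternatingSum-unique g g-zero g-suc (suc m) a d = ≡.trans (g-suc m a d)
    (cong (λ s → head a * head d - s) (alternatingSum-unique g g-zero g-suc m (tail a) (tail d)))

  alternatingSum-cong : ∀ m {a a′ d d′ : Vector Carrier m} → a ≗ a′ → d ≗ d′ →
    alternatingSum m a d ≡ alternatingSum m a′ d′
  alternatingSum-cong zero    a≗a′ d≗d′ = ≡.refl
  alternatingSum-cong (suc m) a≗a′ d≗d′ =
    cong₂ _-_ (cong₂ _*_ (a≗a′ zero) (d≗d′ zero)) (alternatingSum-cong m (a≗a′ ∘ suc) (d≗d′ ∘ suc))

  Σ-cong : ∀ n {f g : Fin n → Carrier} → f ≗ g → Σ[ n ] f ≡ Σ[ n ] g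
  Σ-cong zero    f≗g = ≡.refl
  Σ-cong (suc n) f≗g = cong₂ _+_ (f≗g zero) (Σ-cong n (f≗g ∘ suc))

  trace-cong : ∀ {n} {M M′ : Matrix n} → (∀ i j → M i j ≡ M′ i j) → trace M ≡ trace M′
  trace-cong {n} M≡M′ = Σ-cong n (λ i → M≡M′ i i)

  cofactors : ∀ {n} → Vector (Vector Carrier (suc n)) n → Vector Carrier (suc n)
  cofactors {n} R j = det n (λ i k → R i (punchIn j k))

  -- `det` recurses along the first row through a where-bound helper that cannot be named.
  -- Once its arguments and the size it is lifted over are abstracted by `with`, the
  -- metavariable in the type of `go≡alternatingSum` is solved as that helper.
  mutual
    go≡alternatingSum : ∀ q (M : Matrix (suc q)) m a d → _ ≡ alternatingSum m a d
    go≡alternatingSum q M = alternatingSum-unique _ (λ _ _ → ≡.refl) (λ _ _ _ → ≡.refl)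

    det-suc : ∀ n M → det (suc n) M ≡ alternatingSum (suc n) (head M) (cofactors (tail M))
    det-suc zero    M = ≡.refl
    det-suc (suc p) M
      with tail (tail (head M)) | tail (tail (cofactors (tail M)))
         | cofactors (tail M) zero | cofactors (tail M) (suc zero) | M zero (suc zero)
    ... | a | d | c₀ | c₁ | m₁ with suc p
    ... | q = cong (λ s → M zero zero * c₀ - (m₁ * c₁ - s)) (go≡alternatingSum q M p a d)

  det-cong : ∀ n {M M′ : Matrix n} → (∀ i j → M i j ≡ M′ i j) → det n M ≡ det n M′
  det-cong zero    M≡M′ = ≡.refl
  det-cong (suc n) {M} {M′} M≡M′ = ≡.trans (det-suc n M) (≡.trans
    (alternatingSum-cong (suc n) (M≡M′ zero) (λ j → det-cong n (λ i k → M≡M′ (suc i) (punchIn j k))))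
    (≡.sym (det-suc n M′)))

  solutions : ∀ m → Vector Carrier m → Carrier → Carrier
  solutions m d b = ∑ (vectors m) (λ a → 𝟙 (alternatingSum m a d ≟ b))

  ∑-firstRow : ∀ m d b (w : Carrier → Carrier) →
    ∑ (vectors (suc m)) (λ a → 𝟙 (alternatingSum (suc m) a d ≟ b) * w (head a))
      ≈ ∑ elements (λ x → solutions m (tail d) (x * head d - b) * w x)
  ∑-firstRow m d b w = begin
    ∑ (vectors (suc m)) (λ a → 𝟙 (alternatingSum (suc m) a d ≟ b) * w (head a))
      ≈⟨ ∑-allFuns-suc m elements _ summand-cong ⟩
    ∑ elements (λ x → ∑ (vectors m) (λ g → 𝟙 ((x * head d - alternatingSum m g (tail d)) ≟ b) * w x))
      ≈⟨ ∑-cong elements (λ x → ∑-cong (vectors m) (λ g → *-congʳ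
           (𝟙-cong ((x * head d - alternatingSum m g (tail d)) ≟ b)
                   (alternatingSum m g (tail d) ≟ (x * head d - b)) x-y≈z⇔y≈x-z))) ⟩
    ∑ elements (λ x → ∑ (vectors m) (λ g → 𝟙 (alternatingSum m g (tail d) ≟ (x * head d - b)) * w x))
      ≈⟨ ∑-cong elements (λ x → ∑-*ʳ (vectors m) (w x) _) ⟩
    ∑ elements (λ x → solutions m (tail d) (x * head d - b) * w x)
      ∎
    where
    summand-cong : ∀ {u v} → u ≗ v →
      𝟙 (alternatingSum (suc m) u d ≟ b) * w (head u) ≈ 𝟙 (alternatingSum (suc m) v d ≟ b) * w (head v)
    summand-cong u≗v = reflexive (cong₂ (λ s x → 𝟙 (s ≟ b) * w x)
      (alternatingSum-cong (suc m) {d = d} {d′ = d} u≗v (λ _ → ≡.refl)) (u≗v zero))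

  solutions-suc : ∀ m d b → solutions (suc m) d b ≈ ∑ elements (λ x → solutions m (tail d) (x * head d - b))
  solutions-suc m d b = begin
    solutions (suc m) d b
      ≈⟨ ∑-cong (vectors (suc m)) (λ a → *-identityʳ _) ⟨
    ∑ (vectors (suc m)) (λ a → 𝟙 (alternatingSum (suc m) a d ≟ b) * 1#)
      ≈⟨ ∑-firstRow m d b (λ _ → 1#) ⟩
    ∑ elements (λ x → solutions m (tail d) (x * head d - b) * 1#)
      ≈⟨ ∑-cong elements (λ x → *-identityʳ _) ⟩
    ∑ elements (λ x → solutions m (tail d) (x * head d - b))
      ∎

  solutions-one : ∀ d b → solutions 1 d b ≈ 𝟙 (¬? (head d ≟ 0#))
  solutions-one d b = trans (solutions-suc 0 d b) (cases (head d ≟ 0#))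
    where
    cases : (d₀? : Dec (head d ≈ 0#)) →
      ∑ elements (λ x → 𝟙 (0# ≟ (x * head d - b)) + 0#) ≈ 𝟙 (¬? d₀?)
    cases (yes d₀≈0) = begin
      ∑ elements (λ x → 𝟙 (0# ≟ (x * head d - b)) + 0#)
        ≈⟨ ∑-cong elements (λ x → +-congʳ (𝟙-cong (0# ≟ (x * head d - b)) (0# ≟ (0# - b))
             (mk⇔ (λ e → trans e (+-congʳ (x*d₀≈0 x))) (λ e → trans e (sym (+-congʳ (x*d₀≈0 x))))))) ⟩
      ∑ elements (λ _ → 𝟙 (0# ≟ (0# - b)) + 0#)
        ≈⟨ ∑-elements-const _ ⟩
      0#
        ∎
      where
      x*d₀≈0 : ∀ x → x * head d ≈ 0#
      x*d₀≈0 x = trans (*-congˡ d₀≈0) (zeroʳ x)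
    cases (no d₀≉0) with inverse (head d) d₀≉0
    ... | w , d₀*w≈1 = begin
      ∑ elements (λ x → 𝟙 (0# ≟ (x * head d - b)) + 0#)
        ≈⟨ ∑-cong elements (λ x → trans (+-identityʳ _) (trans
             (𝟙-cong (0# ≟ (x * head d - b)) (x ≟ (b * w)) (⇔.trans 0≈x-y⇔x≈y (x*d≈b⇔x≈b*w d₀*w≈1)))
             (sym (*-identityʳ _)))) ⟩
      ∑ elements (λ x → 𝟙 (x ≟ (b * w)) * 1#)
        ≈⟨ ∑-elements-delta (b * w) (λ _ → 1#) (λ _ → refl) ⟩
      1#
        ∎

  solutions-suc-suc : ∀ m d b → solutions (suc (suc m)) d b ≈ 0#
  solutions-suc-suc zero d b = begin
    solutions 2 d b                                                  ≈⟨ solutions-suc 1 d b ⟩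
    ∑ elements (λ x → solutions 1 (tail d) (x * head d - b))         ≈⟨ ∑-cong elements (λ x → solutions-one (tail d) _) ⟩
    ∑ elements (λ _ → 𝟙 (¬? (d (suc zero) ≟ 0#)))                   ≈⟨ ∑-elements-const _ ⟩
    0#                                                               ∎
  solutions-suc-suc (suc m) d b = begin
    solutions (suc (suc (suc m))) d b                                ≈⟨ solutions-suc (suc (suc m)) d b ⟩
    ∑ elements (λ x → solutions (suc (suc m)) (tail d) (x * head d - b)) ≈⟨ ∑-cong elements (λ x → solutions-suc-suc m (tail d) _) ⟩
    ∑ elements (λ _ → 0#)                                            ≈⟨ ∑-0 elements ⟩
    0#                                                               ∎

  ∑-lowerRows≈0 : ∀ p (τ : Vector (Vector Carrier (suc (suc p))) (suc p) → Carrier) →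
    ∑ (allFuns (suc p) (vectors (suc (suc p))))
      (λ R → ∑ elements (λ x → solutions (suc p) (tail (cofactors R)) (x * head (cofactors R) - 1#) * (x + τ R)))
      ≈ 0#
  ∑-lowerRows≈0 (suc p) τ = begin
    ∑ lowerRows (λ R → ∑ elements (λ x → solutions (suc (suc p)) (tail (cofactors R)) (x * head (cofactors R) - 1#) * (x + τ R)))
      ≈⟨ ∑-cong lowerRows (λ R → ∑-cong elements (λ x →
           trans (*-congʳ (solutions-suc-suc p (tail (cofactors R)) _)) (zeroˡ _))) ⟩
    ∑ lowerRows (λ R → ∑ elements (λ _ → 0#))
      ≈⟨ ∑-cong lowerRows (λ R → ∑-0 elements) ⟩
    ∑ lowerRows (λ R → 0#)
      ≈⟨ ∑-0 lowerRows ⟩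
    0#
      ∎
    where lowerRows = allFuns (suc (suc p)) (vectors (suc (suc (suc p))))
  ∑-lowerRows≈0 zero τ = begin
    ∑ lowerRows (λ R → ∑ elements (λ x → solutions 1 (tail (cofactors R)) (x * head (cofactors R) - 1#) * (x + τ R)))
      ≈⟨ ∑-cong lowerRows (λ R → ∑-cong elements (λ x → *-congʳ (solutions-one (tail (cofactors R)) _))) ⟩
    ∑ lowerRows (λ R → ∑ elements (λ x → κ (R zero zero) * (x + τ R)))
      ≈⟨ ∑-cong lowerRows (λ R → trans (∑-*ˡ elements _ _) (*-congˡ (∑-elements-translate (τ R)))) ⟩
    ∑ lowerRows (λ R → κ (R zero zero) * ∑ elements id)
      ≈⟨ ∑-allFuns-suc 0 (vectors 2) _ (λ R≗R′ → reflexive (cong (λ r → κ (r zero) * ∑ elements id) (R≗R′ zero))) ⟩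
    ∑ (vectors 2) (λ r → κ (head r) * ∑ elements id + 0#)
      ≈⟨ ∑-vectors-head 0 (λ y → κ y * ∑ elements id + 0#) ⟩
    0#
      ∎
    where
    lowerRows = allFuns 1 (vectors 2)
    κ : Carrier → Carrier
    κ y = 𝟙 (¬? ((y * 1# - 0#) ≟ 0#))

  ∑-trace-SL : ∀ n → 2 ≤ n → ∑ (traceVector n) id ≈ 0#
  ∑-trace-SL (suc (suc p)) (s≤s (s≤s z≤n)) = begin
    ∑ (traceVector n) id
      ≡⟨ ∑-map trace (SL n) id ⟩
    ∑ (SL n) trace
      ≈⟨ ∑-filter (λ M → det n M ≟ 1#) (allMatrices n) trace ⟩
    ∑ (allMatrices n) (λ M → 𝟙 (det n M ≟ 1#) * trace M)
      ≈⟨ ∑-allFuns-suc (suc p) (vectors n) _ summand-cong ⟩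
    ∑ (vectors n) (λ a → ∑ lowerRows (λ R → 𝟙 (det n (a Vec.∷ R) ≟ 1#) * trace (a Vec.∷ R)))
      ≈⟨ ∑-swap (vectors n) lowerRows _ ⟩
    ∑ lowerRows (λ R → ∑ (vectors n) (λ a → 𝟙 (det n (a Vec.∷ R) ≟ 1#) * trace (a Vec.∷ R)))
      ≈⟨ ∑-cong lowerRows (λ R → ∑-cong (vectors n) (λ a →
           *-congʳ (reflexive (cong (λ x → 𝟙 (x ≟ 1#)) (det-suc (suc p) (a Vec.∷ R)))))) ⟩
    ∑ lowerRows (λ R → ∑ (vectors n) (λ a → 𝟙 (alternatingSum n a (cofactors R) ≟ 1#) * (head a + t R)))
      ≈⟨ ∑-cong lowerRows (λ R → ∑-firstRow (suc p) (cofactors R) 1# (_+ t R)) ⟩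
    ∑ lowerRows (λ R → ∑ elements (λ x → solutions (suc p) (tail (cofactors R)) (x * head (cofactors R) - 1#) * (x + t R)))
      ≈⟨ ∑-lowerRows≈0 p t ⟩
    0#
      ∎
    where
    n = suc (suc p)
    lowerRows = allFuns (suc p) (vectors n)
    t : Vector (Vector Carrier n) (suc p) → Carrier
    t R = Σ[ suc p ] (λ i → R i (suc i))
    summand-cong : ∀ {M M′} → M ≗ M′ → 𝟙 (det n M ≟ 1#) * trace M ≈ 𝟙 (det n M′ ≟ 1#) * trace M′
    summand-cong M≗M′ = reflexive (cong₂ (λ δ τ → 𝟙 (δ ≟ 1#) * τ) (det-cong n entries) (trace-cong entries))
      where entries = λ i j → cong (_$ j) (M≗M′ i)

  select-complement : ∀ b x → (if not b then x else 0#) + (if b then x else 0#) ≈ x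
  select-complement true  x = +-identityˡ x
  select-complement false x = +-identityʳ x

  dot-complement : ∀ u v → length u ≡ length v → dot (map not u) v + dot u v ≈ ∑ v id
  dot-complement []      []      _      = +-identityˡ 0#
  dot-complement (b ∷ u) (x ∷ v) |u|≡|v| =
    trans (interchange _ _ _ _) (+-cong (select-complement b x) (dot-complement u v (ℕₚ.suc-injective |u|≡|v|)))

  x+y≈0⇒x≈0⇒y≈0 : ∀ {x y} → x + y ≈ 0# → x ≈ 0# → y ≈ 0#
  x+y≈0⇒x≈0⇒y≈0 {x} {y} x+y≈0 x≈0 = trans (+-inverseʳ-unique x y x+y≈0) (trans (-‿cong x≈0) -0#≈0#)

  codeword-complement : ∀ u v → ∑ v id ≈ 0# → length u ≡ length v → (dot (map not u) v ≈ 0#) ⇔ (dot u v ≈ 0#)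
  codeword-complement u v ∑v≈0 |u|≡|v| = mk⇔ (x+y≈0⇒x≈0⇒y≈0 sum≈0) (x+y≈0⇒x≈0⇒y≈0 (trans (+-comm _ _) sum≈0))
    where sum≈0 = trans (dot-complement u v |u|≡|v|) ∑v≈0

  weightDist-symmetric : ∀ n → ∑ (traceVector n) id ≈ 0# → ∀ i → i ≤ N n → weightDist n i ≡ weightDist n (N n ∸ i)
  weightDist-symmetric n ∑v≈0 i i≤N =
    ≡.trans (count-allWords-complement (N n) (codewordOfWeight i)) (count-allWords-cong (N n) complement-swaps)
    where
    codewordOfWeight : ℕ → List Bool → Bool
    codewordOfWeight j u = isCodeword n u ∧ (weight u ℕ.≡ᵇ j)

    complement-swaps : ∀ u → length u ≡ N n → codewordOfWeight i (map not u) ≡ codewordOfWeight (N n ∸ i) u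
    complement-swaps u |u|≡N = cong₂ _∧_
      (does-cong (dot (map not u) (traceVector n) ≟ 0#) (dot u (traceVector n) ≟ 0#)
        (codeword-complement u (traceVector n) ∑v≈0 (≡.trans |u|≡N (≡.sym (length-map trace (SL n))))))
      (≡.trans (cong (ℕ._≡ᵇ i) (≡.trans (weight-complement u) (cong (_∸ weight u) |u|≡N)))
        (does-cong (N n ∸ weight u ℕ.≟ i) (weight u ℕ.≟ N n ∸ i)
          (m∸n≡o⇔n≡m∸o (≡.subst (weight u ≤_) |u|≡N (weight≤length u)) i≤N)))

corollary17 : ∀ {c ℓ : Level} (s r : ℕ) → 1 ≤ s → 1 ≤ r →
    (F : FiniteField c ℓ) → FiniteField.size F ≡ 2 ^ r →
    let open FieldDefs F in
    ∀ (i : ℕ) → i ≤ N (2 ^ s) →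
      weightDist (2 ^ s) i ≡ weightDist (2 ^ s) (N (2 ^ s) ∸ i)
corollary17 s r 1≤s _ F _ = weightDist-symmetric F (2 ^ s) (∑-trace-SL F (2 ^ s) (ℕₚ.^-monoʳ-≤ 2 1≤s))
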